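{- Let $G$ be a finite group and let $S$ be a set of generators of $G$ with $e\in S=S^{ -1}$. Let $\mathfrak{X}_C$ be the configuration coming from the Cayley graph $\mathrm{Cay}(G,S)$, and let $D=\mathrm{diam}\,\mathrm{Cay}(G,S)$. Then the number $WL(\mathfrak{X}_C)$ of nontrivial iterations of the Weisfeiler-Leman algorithm applied to $\mathfrak{X}_C$ satisfies $$WL(\mathfrak{X}_C)=\begin{cases}\lceil\log_2(D-1)\rceil & \text{if for every } g\in G \text{ there is exactly one } g'\in G \text{ with } d(g,g')=D,\\ \lceil \log_2 D\rceil & \text{otherwise.}\end{cases}$$
   Context: The Cayley graph $\mathrm{Cay}(G,S)$ has vertex set $G$ and edge set $\{(g,sg): g\in G, s\in S\}$; $d(g,g')$ denotes the length of a shortest directed path from $g$ to $g'$ and $D$ is the maximum of $d$ over all pairs. The configuration $\mathfrak{X}_C$ is the pair $(G,c)$ with $c(g_1,g_2)=g_2g_1^{ -1}$ if $g_2g_1^{ -1}\in S$ and $c(g_1,g_2)=\emptyset$ (a special symbol) otherwise. Weisfeiler-Leman algorithm: for a set $\Gamma$ with colouring $c:\Gamma^2\to\mathcal{C}$, put $c^{(0)}=c$, $\mathcal{C}^{(0)}=\mathcal{C}$, and define $c^{(h+1)}(v_1,v_2)$ to be the tuple consisting of $c^{(h)}(v_1,v_2)$ together with the family of numbers $\left|\{w\in\Gamma: c^{(h)}(v_1,w)=c_1,\ c^{(h)}(w,v_2)=c_2\}\right|$ indexed by $(c_1,c_2)\in\mathcal{C}^{(h)}\times\mathcal{C}^{(h)}$;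 $\mathcal{C}^{(h+1)}$ is the set of values of $c^{(h+1)}$. The number of nontrivial iterations $WL$ is the least $h\geq0$ such that the partition of $\Gamma^2$ into colour classes of $c^{(h+1)}$ equals that of $c^{(h)}$. -}

module Defs where

open import Data.Nat using (ℕ; zero; suc; _+_; _<_; _≤_)
open import Data.Fin using (Fin)
import Data.Fin as F
open import Data.Fin.Subset using (Subset; _∈_)
open import Data.Fin.Subset.Properties using (_∈?_)
open import Data.Bool using (Bool; true; false; if_then_else_; _∧_)
open import Data.List using (List; []; _∷_; foldr; allFin; map)
open import Data.Nat.ListAction using (sum)
open import Data.List.Relation.Unary.All using (All)
open import Data.Maybe using (Maybe; just; nothing)
import Data.Maybe.Properties as MP
open import Data.Product using (Σ; _×_; _,_; ∃; ∃-syntax)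
open import Relation.Binary.PropositionalEquality using (_≡_)
open import Relation.Nullary using (¬_; Dec; yes; no)
open import Relation.Nullary.Decidable using (isYes)
open import Algebra.Structures using (IsGroup)
open import Level using (0ℓ)

-- A finite group, presented (up to isomorphism) on the carrier Fin n
-- with propositional equality.
record FiniteGroup : Set where
  field
    n       : ℕ
    _∙_     : Fin n → Fin n → Fin n
    ε       : Fin n
    _⁻¹     : Fin n → Fin n
    isGroup : IsGroup _≡_ _∙_ ε _⁻¹

module _ (G : FiniteGroup) where
  open FiniteGroup G

  Elt : Set
  Elt = Fin n

  Generates : Subset n → Set
  Generates S = ∀ (g : Elt) → Σ (List Elt) λ xs → All (_∈ S) xs × foldr _∙_ ε xs ≡ g

  InverseClosed : Subset n → Set
  InverseClosed S = ∀ (s : Elt) → s ∈ S → (s ⁻¹) ∈ S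

  -- Directed walks of length k in Cay(G,S): edges g → s g with s ∈ S.
  data Walk (S : Subset n) : ℕ → Elt → Elt → Set where
    here : ∀ {g} → Walk S zero g g
    step : ∀ {k g g'} (s : Elt) → s ∈ S → Walk S k (s ∙ g) g' → Walk S (suc k) g g'

  IsDist : Subset n → Elt → Elt → ℕ → Set
  IsDist S g g' m = Walk S m g g' × (∀ k → k < m → ¬ Walk S k g g')

  IsDiam : Subset n → ℕ → Set
  IsDiam S D = (∃[ g ] ∃[ g' ] IsDist S g g' D)
             × (∀ g g' m → IsDist S g g' m → m ≤ D)

  -- The colouring of the configuration 𝔛_C:
  -- c(g₁,g₂) = just (g₂ g₁⁻¹) if g₂ g₁⁻¹ ∈ S, and nothing (the symbol ∅) otherwise.
  colour : Subset n → Elt → Elt → Maybe Elt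
  colour S g₁ g₂ with (g₂ ∙ (g₁ ⁻¹)) ∈? S
  ... | yes _ = just (g₂ ∙ (g₁ ⁻¹))
  ... | no  _ = nothing

  count : (Elt → Bool) → ℕ
  count p = sum (map (λ w → if p w then 1 else 0) (allFin n))

  _=ℕ_ : ℕ → ℕ → Bool
  a =ℕ b = isYes (a Data.Nat.≟ b)

  _=C_ : Maybe Elt → Maybe Elt → Bool
  a =C b = isYes (MP.≡-dec F._≟_ a b)

  allB : {A : Set} → (A → Bool) → List A → Bool
  allB p []       = true
  allB p (x ∷ xs) = p x ∧ allB p xs

  -- sameWL S h (v₁,v₂) (u₁,u₂) = true  iff  c^(h)(v₁,v₂) = c^(h)(u₁,u₂).  Level h+1: equal level-h colour and,
  -- for every pair of level-h colours (c₁,c₂) (each colour represented by a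
  -- pair (x₁,x₂) resp. (y₁,y₂) of Γ² having it), equal numbers of w with
  -- c^(h)(v₁,w)=c₁ and c^(h)(w,v₂)=c₂.
  sameWL : Subset n → ℕ → Elt → Elt → Elt → Elt → Bool
  sameWL S zero    v₁ v₂ u₁ u₂ = colour S v₁ v₂ =C colour S u₁ u₂
  sameWL S (suc h) v₁ v₂ u₁ u₂ =
    sameWL S h v₁ v₂ u₁ u₂ ∧
    allB (λ x₁ → allB (λ x₂ → allB (λ y₁ → allB (λ y₂ →
      count (λ w → sameWL S h v₁ w x₁ x₂ ∧ sameWL S h w v₂ y₁ y₂)
      =ℕ
      count (λ w → sameWL S h u₁ w x₁ x₂ ∧ sameWL S h w u₂ y₁ y₂))
      (allFin n)) (allFin n)) (allFin n)) (allFin n)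

  Stable : Subset n → ℕ → Set
  Stable S h = ∀ v₁ v₂ u₁ u₂ → sameWL S (suc h) v₁ v₂ u₁ u₂ ≡ sameWL S h v₁ v₂ u₁ u₂

  IsWL : Subset n → ℕ → Set
  IsWL S h = Stable S h × (∀ k → k < h → ¬ Stable S k)

  UniqueAntipodes : Subset n → ℕ → Set
  UniqueAntipodes S D = ∀ (g : Elt) → ∃[ g' ] (IsDist S g g' D × (∀ g'' → IsDist S g g'' D → g'' ≡ g'))

module Submission where

-- After h rounds the colour of a pair (v₁, v₂) depends only on x = v₂ v₁⁻¹, and two
-- pairs share a colour exactly when their quotients coincide or both lie outside the
-- ball B_h of radius 2^h about e. In the induction step the new colour records the
-- intersection numbers, i.e. the numbers of triangles over x with prescribed old
-- colours on the two other sides. If x ∉ B_(h+1), no such triangle has both sides in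
-- B_h, and all intersection numbers are independent of x; a point x ∈ B_(h+1) is the
-- product of two points of B_h, and that triangle tells x apart from every other point.
-- So the refinement is stable at level h exactly when at most one element lies
-- outside B_h. Since spheres of every radius up to D are nonempty, this first happens
-- when 2^h ≥ D, or already when 2^h ≥ D − 1 if the sphere of radius D about e is a
-- single point, which by translation means that all antipodes are unique.

open import Defs
open import Algebra.Bundles using (Group)
open import Data.Bool using (Bool; true; false; T; _∧_; if_then_else_)
open import Data.Bool.Properties using (T-∧; ∧-zeroʳ; ∧-identityʳ)
open import Data.Empty using (⊥-elim)
open import Data.Fin using (Fin) renaming (_≟_ to _≟ᶠ_)
import Data.Fin as F
open import Data.Fin.Permutation using (permutation)
open import Data.Fin.Properties using (any?; punchInᵢ≢i)
open import Data.Fin.Subset using (Subset; _∈_)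
open import Data.Fin.Subset.Properties using (_∈?_)
open import Data.List using (List; []; _∷_; foldr; tabulate; allFin)
open import Data.List.Membership.Propositional using () renaming (_∈_ to _∈ˡ_)
open import Data.List.Membership.Propositional.Properties using (∈-allFin)
open import Data.List.Properties using (map-tabulate)
open import Data.List.Relation.Unary.All using (All; []; _∷_)
open import Data.List.Relation.Unary.Any using (here; there)
open import Data.Maybe using (Maybe; just; nothing)
open import Data.Maybe.Properties using (just-injective)
open import Data.Nat
  using (ℕ; zero; suc; _+_; _*_; _∸_; _^_; _≤_; _<_; _≤′_; ≤′-refl; ≤′-step; z≤n; s≤s; ⌊_/2⌋; ⌈_/2⌉)
import Data.Nat.Properties as ℕ
open import Data.Nat.ListAction using (sum)
open import Data.Nat.Logarithm using (⌈log₂_⌉; ⌈log₂⌉-mono-≤; ⌈log₂2^n⌉≡n)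
open import Data.Nat.Logarithm.Core using (⌈log2⌉)
open import Data.Nat.Solver using (module +-*-Solver)
open import Data.Product using (_×_; _,_; ∃-syntax; proj₁; proj₂)
open import Data.Product.Function.NonDependent.Propositional using (_×-⇔_)
open import Data.Sum using (_⊎_; inj₁; inj₂)
open import Function using (_∘_; id; _⇔_; mk⇔)
open import Function.Bundles using (module Equivalence)
import Function.Properties.Equivalence as ⇔
open import Induction.WellFounded using (Acc; acc)
open import Level using (0ℓ)
open import Relation.Binary.PropositionalEquality
open import Relation.Nullary using (¬_; Dec; yes; no)
open import Relation.Nullary.Decidable
  using (isYes; isYes≗does; dec-true; dec-false; does-⇔; toWitness; fromWitness; map′; ¬?; _×-dec_; _⊎-dec_)
open import Relation.Unary using (Pred; Decidable)

open import Algebra.Properties.CommutativeMonoid.Sum ℕ.+-0-commutativeMonoid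
  using (sum-cong-≗; sum-remove; sum-replicate-zero; ∑-distrib-+; sum-permute)
  renaming (sum to ∑)

open Equivalence using (to; from)

n≤2^⌈log2⌉n : ∀ n (rec : Acc _<_ n) → n ≤ 2 ^ ⌈log2⌉ n rec
n≤2^⌈log2⌉n zero          _        = z≤n
n≤2^⌈log2⌉n (suc zero)    _        = s≤s z≤n
n≤2^⌈log2⌉n (suc (suc n)) (acc _)  = ℕ.≤-trans 2+n≤2*[1+⌈n/2⌉]
  (ℕ.*-monoʳ-≤ 2 (n≤2^⌈log2⌉n (suc ⌈ n /2⌉) _))
  where
  open +-*-Solver
  open ℕ.≤-Reasoning
  c = ⌈ n /2⌉
  2+n≤2*[1+⌈n/2⌉] : 2 + n ≤ 2 * suc c
  2+n≤2*[1+⌈n/2⌉] = begin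
    2 + n                ≡⟨ cong (2 +_) (ℕ.⌊n/2⌋+⌈n/2⌉≡n n) ⟨
    2 + (⌊ n /2⌋ + c)    ≤⟨ ℕ.+-monoʳ-≤ 2 (ℕ.+-monoˡ-≤ c (ℕ.⌊n/2⌋≤⌈n/2⌉ n)) ⟩
    2 + (c + c)          ≡⟨ solve 1 (λ c → con 2 :+ (c :+ c) := con 2 :* (con 1 :+ c)) refl c ⟩
    2 * suc c            ∎

n≤2^⌈log₂n⌉ : ∀ n → n ≤ 2 ^ ⌈log₂ n ⌉
n≤2^⌈log₂n⌉ n = n≤2^⌈log2⌉n n _

k<⌈log₂n⌉⇒2^k<n : ∀ {k n} → k < ⌈log₂ n ⌉ → 2 ^ k < n
k<⌈log₂n⌉⇒2^k<n {k} {n} k<log = ℕ.≰⇒> λ n≤2^k →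
  ℕ.<⇒≱ k<log (subst (⌈log₂ n ⌉ ≤_) (⌈log₂2^n⌉≡n k) (⌈log₂⌉-mono-≤ n≤2^k))

2^[1+h]≡2^h+2^h : ∀ h → 2 ^ suc h ≡ 2 ^ h + 2 ^ h
2^[1+h]≡2^h+2^h h = cong (2 ^ h +_) (ℕ.+-identityʳ (2 ^ h))

1+2^h≤2^[1+h] : ∀ h → suc (2 ^ h) ≤ 2 ^ suc h
1+2^h≤2^[1+h] h = subst (suc (2 ^ h) ≤_) (sym (2^[1+h]≡2^h+2^h h)) (ℕ.+-monoˡ-≤ (2 ^ h) (ℕ.m^n>0 2 h))

private variable A B C : Set

isYes-true : (a? : Dec A) → A → isYes a? ≡ true
isYes-true a? a = trans (isYes≗does a?) (dec-true a? a)

isYes-false : (a? : Dec A) → ¬ A → isYes a? ≡ false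
isYes-false a? ¬a = trans (isYes≗does a?) (dec-false a? ¬a)

isYes-sound : (a? : Dec A) → isYes a? ≡ true → A
isYes-sound a? eq = toWitness {a? = a?} (subst T (sym eq) _)

isYes-⇔ : A ⇔ B → (a? : Dec A) (b? : Dec B) → isYes a? ≡ isYes b?
isYes-⇔ A⇔B a? b? = trans (isYes≗does a?) (trans (does-⇔ A⇔B a? b?) (sym (isYes≗does b?)))

isYes-×-dec : (a? : Dec A) (b? : Dec B) → isYes a? ∧ isYes b? ≡ isYes (a? ×-dec b?)
isYes-×-dec (yes _) (yes _) = refl
isYes-×-dec (yes _) (no _)  = refl
isYes-×-dec (no _)  _       = refl

-- One refinement round conjoins the old colour test with a test that implies it.
∧-isYes : (a? : Dec A) (c? : Dec C) (b : Bool) →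
          (T b ⇔ C) → (C → A) → isYes a? ∧ b ≡ isYes c?
∧-isYes a? c? false b⇔C _   = trans (∧-zeroʳ _) (sym (isYes-false c? (from b⇔C)))
∧-isYes a? c? true  b⇔C C⇒A = trans (∧-identityʳ _)
  (trans (isYes-true a? (C⇒A c)) (sym (isYes-true c? c)))
  where c = to b⇔C _

𝟙 : Bool → ℕ
𝟙 b = if b then 1 else 0

sum-tabulate : ∀ {m} (f : Fin m → ℕ) → sum (tabulate f) ≡ ∑ f
sum-tabulate {zero}  f = refl
sum-tabulate {suc m} f = cong (f F.zero +_) (sum-tabulate (f ∘ F.suc))

∑-𝟙-≟ : ∀ {m} (c : Fin m) → ∑ (λ w → 𝟙 (isYes (w ≟ᶠ c))) ≡ 1
∑-𝟙-≟ {suc m} c = begin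
  ∑ t                                  ≡⟨ sum-remove {i = c} t ⟩
  t c + ∑ (λ j → t (F.punchIn c j))    ≡⟨ cong₂ _+_ (cong 𝟙 (isYes-true (c ≟ᶠ c) refl)) rest≡0 ⟩
  1                                    ∎
  where
  open ≡-Reasoning
  t = λ w → 𝟙 (isYes (w ≟ᶠ c))
  rest≡0 : ∑ (λ j → t (F.punchIn c j)) ≡ 0
  rest≡0 = trans (sum-cong-≗ (λ j → cong 𝟙 (isYes-false _ (punchInᵢ≢i c j)))) (sum-replicate-zero m)

∑-ones : ∀ {m} (f : Fin m → ℕ) → (∀ w → f w ≡ 1) → ∑ f ≡ m
∑-ones {zero}  f _    = refl
∑-ones {suc m} f f≡1 = cong₂ _+_ (f≡1 F.zero) (∑-ones (f ∘ F.suc) (f≡1 ∘ F.suc))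

module Counting (G : FiniteGroup) where
  open FiniteGroup G using (n)

  count≡∑ : (p : Fin n → Bool) → count G p ≡ ∑ (𝟙 ∘ p)
  count≡∑ p = trans (cong sum (map-tabulate id (𝟙 ∘ p))) (sum-tabulate (𝟙 ∘ p))

  count-cong : {p q : Fin n → Bool} → (∀ w → p w ≡ q w) → count G p ≡ count G q
  count-cong {p} {q} p≗q = trans (count≡∑ p) (trans (sum-cong-≗ (cong 𝟙 ∘ p≗q)) (sym (count≡∑ q)))

  count-⇔ : {P Q : Pred (Fin n) 0ℓ} (P? : Decidable P) (Q? : Decidable Q) →
            (∀ w → P w ⇔ Q w) → count G (isYes ∘ P?) ≡ count G (isYes ∘ Q?)
  count-⇔ P? Q? P⇔Q = count-cong λ w → isYes-⇔ (P⇔Q w) (P? w) (Q? w)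

  count-permute : (p : Fin n → Bool) (π π⁻¹ : Fin n → Fin n) →
                  (∀ z → π (π⁻¹ z) ≡ z) → (∀ z → π⁻¹ (π z) ≡ z) → count G (p ∘ π) ≡ count G p
  count-permute p π π⁻¹ πˡ πʳ = begin
    count G (p ∘ π)    ≡⟨ count≡∑ (p ∘ π) ⟩
    ∑ (𝟙 ∘ p ∘ π)      ≡⟨ sum-permute (𝟙 ∘ p) (permutation π π⁻¹ πˡ πʳ) ⟨
    ∑ (𝟙 ∘ p)          ≡⟨ count≡∑ p ⟨
    count G p          ∎
    where open ≡-Reasoning

  count-∅ : {P : Pred (Fin n) 0ℓ} (P? : Decidable P) → (∀ w → ¬ P w) → count G (isYes ∘ P?) ≡ 0
  count-∅ P? ∅ = trans (count≡∑ _) (trans (sum-cong-≗ λ w → cong 𝟙 (isYes-false (P? w) (∅ w)))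
                                          (sum-replicate-zero n))

  count-≟ : (c : Fin n) → count G (λ w → isYes (w ≟ᶠ c)) ≡ 1
  count-≟ c = trans (count≡∑ _) (∑-𝟙-≟ c)

  count-partition : {P Q R : Pred (Fin n) 0ℓ} (P? : Decidable P) (Q? : Decidable Q) (R? : Decidable R) →
                    (∀ w → ¬ (P w × Q w)) → (∀ w → R w ⇔ (¬ P w × ¬ Q w)) →
                    count G (isYes ∘ P?) + count G (isYes ∘ Q?) + count G (isYes ∘ R?) ≡ n
  count-partition {P} {Q} {R} P? Q? R? disjoint R⇔ = begin
    count G p + count G q + count G r
      ≡⟨ cong₂ _+_ (cong₂ _+_ (count≡∑ p) (count≡∑ q)) (count≡∑ r) ⟩
    ∑ (𝟙 ∘ p) + ∑ (𝟙 ∘ q) + ∑ (𝟙 ∘ r)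
      ≡⟨ cong (_+ ∑ (𝟙 ∘ r)) (∑-distrib-+ (𝟙 ∘ p) (𝟙 ∘ q)) ⟨
    ∑ (λ w → 𝟙 (p w) + 𝟙 (q w)) + ∑ (𝟙 ∘ r)
      ≡⟨ ∑-distrib-+ (λ w → 𝟙 (p w) + 𝟙 (q w)) (𝟙 ∘ r) ⟨
    ∑ (λ w → 𝟙 (p w) + 𝟙 (q w) + 𝟙 (r w))
      ≡⟨ ∑-ones _ exactly-one ⟩
    n ∎
    where
    open ≡-Reasoning
    p = isYes ∘ P?
    q = isYes ∘ Q?
    r = isYes ∘ R?
    exactly-one : ∀ w → 𝟙 (p w) + 𝟙 (q w) + 𝟙 (r w) ≡ 1
    exactly-one w with P? w | Q? w
    ... | yes Pw | yes Qw = ⊥-elim (disjoint w (Pw , Qw))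
    ... | yes Pw | no  _  = cong (suc ∘ 𝟙) (isYes-false (R? w) λ Rw → proj₁ (to (R⇔ w) Rw) Pw)
    ... | no  _  | yes Qw = cong (suc ∘ 𝟙) (isYes-false (R? w) λ Rw → proj₂ (to (R⇔ w) Rw) Qw)
    ... | no ¬Pw | no ¬Qw = cong 𝟙 (isYes-true (R? w) (from (R⇔ w) (¬Pw , ¬Qw)))

module Cayley (G : FiniteGroup) (S : Subset (FiniteGroup.n G)) (ε∈S : FiniteGroup.ε G ∈ S) where
  open FiniteGroup G using (n; isGroup)
  open Counting G

  group : Group 0ℓ 0ℓ
  group = record { isGroup = isGroup }

  open Group group using (_∙_; ε; _⁻¹; _//_; _\\_; assoc; identityˡ; identityʳ; inverseʳ)
  open import Algebra.Properties.Group group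
    using ( ε⁻¹≈ε; ⁻¹-involutive; ⁻¹-anti-homo-∙
          ; \\-leftDividesˡ; \\-leftDividesʳ; //-rightDividesˡ; //-rightDividesʳ)

  x//ε≡x : ∀ x → x // ε ≡ x
  x//ε≡x x = trans (cong (x ∙_) ε⁻¹≈ε) (identityʳ x)

  [x//z]//[y//z]≡x//y : ∀ x y z → (x // z) // (y // z) ≡ x // y
  [x//z]//[y//z]≡x//y x y z = begin
    (x // z) ∙ (y // z) ⁻¹       ≡⟨ cong ((x // z) ∙_) (⁻¹-anti-homo-∙ y (z ⁻¹)) ⟩
    (x // z) ∙ (z ⁻¹ ⁻¹ ∙ y ⁻¹)  ≡⟨ cong (λ t → (x // z) ∙ (t ∙ y ⁻¹)) (⁻¹-involutive z) ⟩
    (x // z) ∙ (z ∙ y ⁻¹)        ≡⟨ assoc (x // z) z (y ⁻¹) ⟨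
    (x // z) ∙ z ∙ y ⁻¹          ≡⟨ cong (_∙ y ⁻¹) (//-rightDividesˡ z x) ⟩
    x // y                       ∎
    where open ≡-Reasoning

  //-cancelʳ : ∀ {x y z} → x // z ≡ y // z → x ≡ y
  //-cancelʳ {x} {y} {z} eq = begin
    x            ≡⟨ //-rightDividesˡ z x ⟨
    (x // z) ∙ z ≡⟨ cong (_∙ z) eq ⟩
    (y // z) ∙ z ≡⟨ //-rightDividesˡ z y ⟩
    y            ∎
    where open ≡-Reasoning

  x//[z\\x]≡z : ∀ x z → x // (z \\ x) ≡ z
  x//[z\\x]≡z x z = begin
    x // (z \\ x)                ≡⟨ cong (_// (z \\ x)) (\\-leftDividesˡ z x) ⟨
    (z ∙ (z \\ x)) // (z \\ x)   ≡⟨ //-rightDividesʳ (z \\ x) z ⟩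
    z                            ∎
    where open ≡-Reasoning

  [x//z]\\x≡z : ∀ x z → (x // z) \\ x ≡ z
  [x//z]\\x≡z x z = begin
    (x // z) \\ x                ≡⟨ cong ((x // z) \\_) (//-rightDividesˡ z x) ⟨
    (x // z) \\ ((x // z) ∙ z)   ≡⟨ \\-leftDividesʳ (x // z) z ⟩
    z                            ∎
    where open ≡-Reasoning

  walk-∙ʳ : ∀ {k g g'} → Walk G S k g g' → ∀ c → Walk G S k (g ∙ c) (g' ∙ c)
  walk-∙ʳ here                          c = here
  walk-∙ʳ {suc k} {g' = g'} (step {g = g} s s∈ p) c =
    step s s∈ (subst (λ z → Walk G S k z (g' ∙ c)) (assoc s g c) (walk-∙ʳ p c))

  walk-++ : ∀ {k m g a c} → Walk G S k g a → Walk G S m a c → Walk G S (k + m) g c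
  walk-++ here           q = q
  walk-++ (step s s∈ p) q = step s s∈ (walk-++ p q)

  walk-split : ∀ k {m g c} → Walk G S (k + m) g c → ∃[ a ] (Walk G S k g a × Walk G S m a c)
  walk-split zero    p = _ , here , p
  walk-split (suc k) (step s s∈ p) =
    let a , p₁ , p₂ = walk-split k p in a , step s s∈ p₁ , p₂

  walk-suc : ∀ {k g x} → Walk G S k g x → Walk G S (suc k) g x
  walk-suc {k} {g} {x} p = step ε ε∈S (subst (λ z → Walk G S k z x) (sym (identityˡ g)) p)

  walk-pad : ∀ {k m g x} → k ≤ m → Walk G S k g x → Walk G S m g x
  walk-pad = pad ∘ ℕ.≤⇒≤′
    where
    pad : ∀ {k m g x} → k ≤′ m → Walk G S k g x → Walk G S m g x
    pad ≤′-refl       p = p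
    pad (≤′-step k≤m) p = walk-suc (pad k≤m p)

  walk-toε : ∀ {k g g'} → Walk G S k g g' → Walk G S k ε (g' // g)
  walk-toε {k} {g} {g'} p = subst (λ z → Walk G S k z (g' // g)) (inverseʳ g) (walk-∙ʳ p (g ⁻¹))

  walk-fromε : ∀ {k g g'} → Walk G S k ε (g' // g) → Walk G S k g g'
  walk-fromε {k} {g} {g'} p = subst₂ (Walk G S k) (identityˡ g) (//-rightDividesˡ g g') (walk-∙ʳ p g)

  walk? : ∀ k g g' → Dec (Walk G S k g g')
  walk? zero g g' = map′ (λ { refl → here }) (λ { here → refl }) (g ≟ᶠ g')
  walk? (suc k) g g' = map′ (λ (s , s∈ , p) → step s s∈ p) (λ { (step s s∈ p) → s , s∈ , p })
    (any? λ s → (s ∈? S) ×-dec walk? k (s ∙ g) g')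

  shortest : ∀ m {g x} → Walk G S m g x → ∃[ j ] IsDist G S g x j
  shortest zero          p = zero , p , λ _ ()
  shortest (suc m) {g} {x} p with walk? m g x
  ... | yes q = shortest m q
  ... | no ¬q = suc m , p , λ k k<1+m q → ¬q (walk-pad (ℕ.≤-pred k<1+m) q)

  dist-toε : ∀ {g g' m} → IsDist G S g g' m → IsDist G S ε (g' // g) m
  dist-toε (p , far) = walk-toε p , λ k k<m q → far k k<m (walk-fromε q)

  dist-fromε : ∀ {g g' m} → IsDist G S ε (g' // g) m → IsDist G S g g' m
  dist-fromε (p , far) = walk-fromε p , λ k k<m q → far k k<m (walk-toε q)

  geodesic-prefix : ∀ {r m x} → r ≤ m → IsDist G S ε x m → ∃[ z ] IsDist G S ε z r
  geodesic-prefix {r} {m} {x} r≤m (p , far)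
    with walk-split r (subst (λ j → Walk G S j ε x) (sym (ℕ.m+[n∸m]≡n r≤m)) p)
  ... | z , p₁ , p₂ = z , p₁ , λ k k<r q →
    far (k + (m ∸ r)) (subst (k + (m ∸ r) <_) (ℕ.m+[n∸m]≡n r≤m) (ℕ.+-monoˡ-< (m ∸ r) k<r)) (walk-++ q p₂)

  -- Level h of the refinement sees the ball of radius 2 ^ h, not h.
  record Ball (h : ℕ) (x : Fin n) : Set where
    constructor ball
    field walk : Walk G S (2 ^ h) ε x

  ball? : ∀ h x → Dec (Ball h x)
  ball? h x = map′ ball Ball.walk (walk? (2 ^ h) ε x)

  ball-⊆ : ∀ {h x} → Ball h x → Ball (suc h) x
  ball-⊆ {h} (ball p) = ball (walk-pad (ℕ.≤-trans (ℕ.n≤1+n (2 ^ h)) (1+2^h≤2^[1+h] h)) p)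

  ball-∙ : ∀ {h a b} → Ball h a → Ball h b → Ball (suc h) (b ∙ a)
  ball-∙ {h} {a} {b} (ball p) (ball q) = ball (subst (λ k → Walk G S k ε (b ∙ a)) (sym (2^[1+h]≡2^h+2^h h))
    (walk-++ p (subst (λ z → Walk G S (2 ^ h) z (b ∙ a)) (identityˡ a) (walk-∙ʳ q a))))

  ball-split : ∀ {h x} → Ball (suc h) x → ∃[ a ] (Ball h a × Ball h (x // a))
  ball-split {h} {x} (ball p) with walk-split (2 ^ h) (subst (λ k → Walk G S k ε x) (2^[1+h]≡2^h+2^h h) p)
  ... | a , p₁ , p₂ = a , ball p₁ , ball (walk-toε p₂)

  //-∉ball : ∀ {h x z} → ¬ Ball (suc h) x → Ball h z → ¬ Ball h (x // z)
  //-∉ball {x = x} {z} x∉ z∈ x//z∈ = x∉ (subst (Ball _) (//-rightDividesˡ z x) (ball-∙ z∈ x//z∈))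

  ball₀⇔∈S : ∀ {x} → Ball 0 x ⇔ x ∈ S
  ball₀⇔∈S {x} = mk⇔ ball₀⇒∈S
    (λ x∈ → ball (step x x∈ (subst (λ z → Walk G S 0 z x) (sym (identityʳ x)) here)))
    where
    ball₀⇒∈S : ∀ {y} → Ball 0 y → y ∈ S
    ball₀⇒∈S (ball (step s s∈ here)) = subst (_∈ S) (sym (identityʳ s)) s∈

  SameClass : ℕ → Fin n → Fin n → Set
  SameClass h x y = x ≡ y ⊎ (¬ Ball h x × ¬ Ball h y)

  sameClass? : ∀ h x y → Dec (SameClass h x y)
  sameClass? h x y = (x ≟ᶠ y) ⊎-dec (¬? (ball? h x) ×-dec ¬? (ball? h y))

  sameClass-pred : ∀ {h x y} → SameClass (suc h) x y → SameClass h x y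
  sameClass-pred (inj₁ x≡y)        = inj₁ x≡y
  sameClass-pred (inj₂ (x∉ , y∉)) = inj₂ (x∉ ∘ ball-⊆ , y∉ ∘ ball-⊆)

  sameClass-ball : ∀ {h z a} → Ball h a → SameClass h z a ⇔ z ≡ a
  sameClass-ball a∈ = mk⇔ (λ { (inj₁ z≡a) → z≡a ; (inj₂ (_ , a∉)) → ⊥-elim (a∉ a∈) }) inj₁

  sameClass-outside : ∀ {h z a} → ¬ Ball h a → SameClass h z a ⇔ (¬ Ball h z)
  sameClass-outside a∉ = mk⇔ (λ { (inj₁ refl) → a∉ ; (inj₂ (z∉ , _)) → z∉ }) (λ z∉ → inj₂ (z∉ , a∉))

  Triangle : ℕ → (x a b : Fin n) → Fin n → Set
  Triangle h x a b z = SameClass h z a × SameClass h (x // z) b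

  triangle? : ∀ h x a b z → Dec (Triangle h x a b z)
  triangle? h x a b z = sameClass? h z a ×-dec sameClass? h (x // z) b

  intersection : ℕ → (x a b : Fin n) → ℕ
  intersection h x a b = count G (isYes ∘ triangle? h x a b)

  ballSize : ℕ → ℕ
  ballSize h = count G (isYes ∘ ball? h)

  module _ {h x} (x∉ : ¬ Ball (suc h) x) where

    intersection-in-in : ∀ {a b} → Ball h a → Ball h b → intersection h x a b ≡ 0
    intersection-in-in a∈ b∈ = count-∅ (triangle? h x _ _) λ { z (z~a , x//z~b) →
      //-∉ball x∉ (subst (Ball h) (sym (to (sameClass-ball a∈) z~a)) a∈)
                  (subst (Ball h) (sym (to (sameClass-ball b∈) x//z~b)) b∈) }

    intersection-in-out : ∀ {a b} → Ball h a → ¬ Ball h b → intersection h x a b ≡ 1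
    intersection-in-out {a} {b} a∈ b∉ = trans (count-⇔ (triangle? h x a b) (_≟ᶠ a) triangle⇔) (count-≟ a)
      where
      triangle⇔ : ∀ z → Triangle h x a b z ⇔ z ≡ a
      triangle⇔ z = mk⇔ (to (sameClass-ball a∈) ∘ proj₁)
        λ { refl → inj₁ refl , from (sameClass-outside b∉) (//-∉ball x∉ a∈) }

    intersection-out-in : ∀ {a b} → ¬ Ball h a → Ball h b → intersection h x a b ≡ 1
    intersection-out-in {a} {b} a∉ b∈ = begin
      intersection h x a b                        ≡⟨ count-⇔ (triangle? h x a b) (λ z → x // z ≟ᶠ b) triangle⇔ ⟩
      count G ((λ w → isYes (w ≟ᶠ b)) ∘ (x //_))
        ≡⟨ count-permute _ (x //_) (_\\ x) (x//[z\\x]≡z x) ([x//z]\\x≡z x) ⟩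
      count G (λ w → isYes (w ≟ᶠ b))              ≡⟨ count-≟ b ⟩
      1                                           ∎
      where
      open ≡-Reasoning
      triangle⇔ : ∀ z → Triangle h x a b z ⇔ x // z ≡ b
      triangle⇔ z = mk⇔ (to (sameClass-ball b∈) ∘ proj₂)
        λ x//z≡b → from (sameClass-outside a∉)
                     (λ z∈ → //-∉ball x∉ z∈ (subst (Ball h) (sym x//z≡b) b∈)) , inj₁ x//z≡b

    intersection-out-out : ∀ {a b} → ¬ Ball h a → ¬ Ball h b → ballSize h + ballSize h + intersection h x a b ≡ n
    intersection-out-out {a} {b} a∉ b∉ = begin
      ballSize h + ballSize h + intersection h x a b
        ≡⟨ cong (λ t → ballSize h + t + intersection h x a b)
                (count-permute _ (x //_) (_\\ x) (x//[z\\x]≡z x) ([x//z]\\x≡z x)) ⟨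
      ballSize h + count G (isYes ∘ ball? h ∘ (x //_)) + intersection h x a b
        ≡⟨ count-partition (ball? h) (ball? h ∘ (x //_)) (triangle? h x a b)
                           (λ z (z∈ , x//z∈) → //-∉ball x∉ z∈ x//z∈)
                           (λ z → sameClass-outside a∉ ×-⇔ sameClass-outside b∉) ⟩
      n ∎
      where open ≡-Reasoning

  intersection-outside : ∀ {h x y} → ¬ Ball (suc h) x → ¬ Ball (suc h) y →
                         ∀ a b → intersection h x a b ≡ intersection h y a b
  intersection-outside {h} {x} {y} x∉ y∉ a b = by-cases (ball? h a) (ball? h b)
    where
    by-cases : Dec (Ball h a) → Dec (Ball h b) → intersection h x a b ≡ intersection h y a b
    by-cases (yes a∈) (yes b∈) = trans (intersection-in-in x∉ a∈ b∈) (sym (intersection-in-in y∉ a∈ b∈))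
    by-cases (yes a∈) (no  b∉) = trans (intersection-in-out x∉ a∈ b∉) (sym (intersection-in-out y∉ a∈ b∉))
    by-cases (no  a∉) (yes b∈) = trans (intersection-out-in x∉ a∉ b∈) (sym (intersection-out-in y∉ a∉ b∈))
    by-cases (no  a∉) (no  b∉) = ℕ.+-cancelˡ-≡ (ballSize h + ballSize h) _ _
      (trans (intersection-out-out x∉ a∉ b∉) (sym (intersection-out-out y∉ a∉ b∉)))

  intersection-separates : ∀ {h x y} → Ball (suc h) x → x ≢ y →
                           ∃[ a ] ∃[ b ] (intersection h x a b ≡ 1 × intersection h y a b ≡ 0)
  intersection-separates {h} {x} {y} x∈ x≢y with ball-split {h} x∈
  ... | a , a∈ , x//a∈ = a , x // a , count-1 , count-0
    where
    to-a : ∀ {v z} → Triangle h v a (x // a) z → z ≡ a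
    to-a = to (sameClass-ball a∈) ∘ proj₁
    count-1 : intersection h x a (x // a) ≡ 1
    count-1 = trans (count-⇔ (triangle? h x a (x // a)) (_≟ᶠ a)
                (λ z → mk⇔ to-a λ { refl → inj₁ refl , inj₁ refl }))
              (count-≟ a)
    count-0 : intersection h y a (x // a) ≡ 0
    count-0 = count-∅ (triangle? h y a (x // a)) λ z t → x≢y (sym (//-cancelʳ
      (subst (λ w → y // w ≡ x // a) (to-a t) (to (sameClass-ball x//a∈) (proj₂ t)))))

  label : Fin n → Maybe (Fin n)
  label x with x ∈? S
  ... | yes _ = just x
  ... | no  _ = nothing

  colour≡label : ∀ g₁ g₂ → colour G S g₁ g₂ ≡ label (g₂ // g₁)
  colour≡label g₁ g₂ with (g₂ // g₁) ∈? S
  ... | yes _ = refl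
  ... | no  _ = refl

  label-≡⇔sameClass₀ : ∀ x y → label x ≡ label y ⇔ SameClass 0 x y
  label-≡⇔sameClass₀ x y with x ∈? S | y ∈? S
  ... | yes x∈ | yes _  = mk⇔ (inj₁ ∘ just-injective)
    λ { (inj₁ refl) → refl ; (inj₂ (x∉ , _)) → ⊥-elim (x∉ (from ball₀⇔∈S x∈)) }
  ... | yes x∈ | no  y∉ = mk⇔ (λ ())
    λ { (inj₁ refl) → ⊥-elim (y∉ x∈) ; (inj₂ (x∉ , _)) → ⊥-elim (x∉ (from ball₀⇔∈S x∈)) }
  ... | no  x∉ | yes y∈ = mk⇔ (λ ())
    λ { (inj₁ refl) → ⊥-elim (x∉ y∈) ; (inj₂ (_ , y∉)) → ⊥-elim (y∉ (from ball₀⇔∈S y∈)) }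
  ... | no  x∉ | no  y∉ = mk⇔ (λ _ → inj₂ (x∉ ∘ to ball₀⇔∈S , y∉ ∘ to ball₀⇔∈S)) (λ _ → refl)

  intersections-agree⇔sameClass : ∀ {h x y} →
    (∀ a b → intersection h x a b ≡ intersection h y a b) ⇔ SameClass (suc h) x y
  intersections-agree⇔sameClass {h} {x} {y} = mk⇔ agree⇒sameClass sameClass⇒agree
    where
    separated : ∀ {x y} → Ball (suc h) x → x ≢ y → ¬ (∀ a b → intersection h x a b ≡ intersection h y a b)
    separated x∈ x≢y agree with intersection-separates x∈ x≢y
    ... | a , b , x-count≡1 , y-count≡0 = ℕ.1+n≢0 (trans (sym x-count≡1) (trans (agree a b) y-count≡0))
    agree⇒sameClass : (∀ a b → intersection h x a b ≡ intersection h y a b) → SameClass (suc h) x y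
    agree⇒sameClass agree with x ≟ᶠ y | ball? (suc h) x | ball? (suc h) y
    ... | yes x≡y | _      | _      = inj₁ x≡y
    ... | no  x≢y | yes x∈ | _      = ⊥-elim (separated x∈ x≢y agree)
    ... | no  x≢y | no  _  | yes y∈ = ⊥-elim (separated y∈ (x≢y ∘ sym) λ a b → sym (agree a b))
    ... | no  _   | no  x∉ | no  y∉ = inj₂ (x∉ , y∉)
    sameClass⇒agree : SameClass (suc h) x y → ∀ a b → intersection h x a b ≡ intersection h y a b
    sameClass⇒agree (inj₁ refl)       a b = refl
    sameClass⇒agree (inj₂ (x∉ , y∉)) = intersection-outside x∉ y∉

  ColoursAreClasses : ℕ → Set
  ColoursAreClasses h =
    ∀ v₁ v₂ u₁ u₂ → sameWL G S h v₁ v₂ u₁ u₂ ≡ isYes (sameClass? h (v₂ // v₁) (u₂ // u₁))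

  wl-count≡intersection : ∀ {h} → ColoursAreClasses h → ∀ v₁ v₂ x₁ x₂ y₁ y₂ →
    count G (λ w → sameWL G S h v₁ w x₁ x₂ ∧ sameWL G S h w v₂ y₁ y₂)
      ≡ intersection h (v₂ // v₁) (x₂ // x₁) (y₂ // y₁)
  wl-count≡intersection {h} classes v₁ v₂ x₁ x₂ y₁ y₂ = begin
    count G (λ w → sameWL G S h v₁ w x₁ x₂ ∧ sameWL G S h w v₂ y₁ y₂)
      ≡⟨ count-cong (λ w → trans (cong₂ _∧_ (classes v₁ w x₁ x₂) (classes w v₂ y₁ y₂)) (reindex w)) ⟩
    count G (isYes ∘ triangle? h (v₂ // v₁) a b ∘ (_// v₁))
      ≡⟨ count-permute _ (_// v₁) (_∙ v₁) (//-rightDividesʳ v₁) (//-rightDividesˡ v₁) ⟩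
    intersection h (v₂ // v₁) a b
      ∎
    where
    open ≡-Reasoning
    a = x₂ // x₁
    b = y₂ // y₁
    reindex : ∀ w → isYes (sameClass? h (w // v₁) a) ∧ isYes (sameClass? h (v₂ // w) b)
                    ≡ isYes (triangle? h (v₂ // v₁) a b (w // v₁))
    reindex w = trans (cong (λ t → isYes (sameClass? h (w // v₁) a) ∧ isYes (sameClass? h t b))
                            (sym ([x//z]//[y//z]≡x//y v₂ w v₁)))
                      (isYes-×-dec (sameClass? h (w // v₁) a) (sameClass? h (v₂ // v₁ // (w // v₁)) b))

  T-allB : {A : Set} (p : A → Bool) (xs : List A) → (∀ x → T (p x)) → T (allB G p xs)
  T-allB p []       _   = _
  T-allB p (x ∷ xs) all = from T-∧ (all x , T-allB p xs all)

  T-allB⁻ : {A : Set} (p : A → Bool) (xs : List A) → T (allB G p xs) → ∀ {x} → x ∈ˡ xs → T (p x)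
  T-allB⁻ p (x ∷ xs) t (here refl) = proj₁ (to T-∧ t)
  T-allB⁻ p (x ∷ xs) t (there x∈) = T-allB⁻ p xs (proj₂ (to T-∧ t)) x∈

  module Refinement {h} (classes : ColoursAreClasses h) (v₁ v₂ u₁ u₂ : Fin n) where
    x = v₂ // v₁
    y = u₂ // u₁
    L = allFin n

    counts-agree : Bool
    counts-agree = allB G (λ x₁ → allB G (λ x₂ → allB G (λ y₁ → allB G (λ y₂ →
      _=ℕ_ G (count G (λ w → sameWL G S h v₁ w x₁ x₂ ∧ sameWL G S h w v₂ y₁ y₂))
             (count G (λ w → sameWL G S h u₁ w x₁ x₂ ∧ sameWL G S h w u₂ y₁ y₂))) L) L) L) L

    counts-agree⇔ : T counts-agree ⇔ (∀ a b → intersection h x a b ≡ intersection h y a b)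
    counts-agree⇔ = mk⇔ counts⇒intersections intersections⇒counts
      where
      counts⇒intersections : T counts-agree → ∀ a b → intersection h x a b ≡ intersection h y a b
      counts⇒intersections t a b =
        subst₂ (λ a′ b′ → intersection h x a′ b′ ≡ intersection h y a′ b′) (x//ε≡x a) (x//ε≡x b)
        (trans (sym (wl-count≡intersection classes v₁ v₂ ε a ε b))
        (trans (toWitness at-εaεb) (wl-count≡intersection classes u₁ u₂ ε a ε b)))
        where
        at-εaεb = T-allB⁻ _ L (T-allB⁻ _ L (T-allB⁻ _ L (T-allB⁻ _ L t
                    (∈-allFin ε)) (∈-allFin a)) (∈-allFin ε)) (∈-allFin b)
      intersections⇒counts : (∀ a b → intersection h x a b ≡ intersection h y a b) → T counts-agree
      intersections⇒counts agree =
        T-allB _ L λ x₁ → T-allB _ L λ x₂ → T-allB _ L λ y₁ → T-allB _ L λ y₂ → fromWitness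
        (trans (wl-count≡intersection classes v₁ v₂ x₁ x₂ y₁ y₂)
        (trans (agree _ _) (sym (wl-count≡intersection classes u₁ u₂ x₁ x₂ y₁ y₂))))

  sameWL≡sameClass : ∀ h → ColoursAreClasses h
  sameWL≡sameClass zero v₁ v₂ u₁ u₂ = begin
    _=C_ G (colour G S v₁ v₂) (colour G S u₁ u₂)
      ≡⟨ cong₂ (_=C_ G) (colour≡label v₁ v₂) (colour≡label u₁ u₂) ⟩
    _=C_ G (label (v₂ // v₁)) (label (u₂ // u₁))
      ≡⟨ isYes-⇔ (label-≡⇔sameClass₀ _ _) _ _ ⟩
    isYes (sameClass? 0 (v₂ // v₁) (u₂ // u₁))
      ∎
    where open ≡-Reasoning
  sameWL≡sameClass (suc h) v₁ v₂ u₁ u₂ = begin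
    sameWL G S h v₁ v₂ u₁ u₂ ∧ counts-agree
      ≡⟨ cong (_∧ counts-agree) (sameWL≡sameClass h v₁ v₂ u₁ u₂) ⟩
    isYes (sameClass? h x y) ∧ counts-agree
      ≡⟨ ∧-isYes _ _ counts-agree (⇔.trans counts-agree⇔ intersections-agree⇔sameClass) sameClass-pred ⟩
    isYes (sameClass? (suc h) x y)
      ∎
    where
    open ≡-Reasoning
    open Refinement (sameWL≡sameClass h) v₁ v₂ u₁ u₂

  sameWL-from-ε : ∀ h x y → sameWL G S h ε x ε y ≡ isYes (sameClass? h x y)
  sameWL-from-ε h x y = trans (sameWL≡sameClass h ε x ε y)
                              (cong₂ (λ x′ y′ → isYes (sameClass? h x′ y′)) (x//ε≡x x) (x//ε≡x y))

  AtMostOneOutside : ℕ → Set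
  AtMostOneOutside h = ∀ x y → ¬ Ball h x → ¬ Ball h y → x ≡ y

  atMostOneOutside⇒stable : ∀ {h} → AtMostOneOutside h → Stable G S h
  atMostOneOutside⇒stable {h} one-outside v₁ v₂ u₁ u₂ = begin
    sameWL G S (suc h) v₁ v₂ u₁ u₂                  ≡⟨ sameWL≡sameClass (suc h) v₁ v₂ u₁ u₂ ⟩
    isYes (sameClass? (suc h) (v₂ // v₁) (u₂ // u₁)) ≡⟨ isYes-⇔ (mk⇔ sameClass-pred merged) _ _ ⟩
    isYes (sameClass? h (v₂ // v₁) (u₂ // u₁))       ≡⟨ sameWL≡sameClass h v₁ v₂ u₁ u₂ ⟨
    sameWL G S h v₁ v₂ u₁ u₂                        ∎
    where
    open ≡-Reasoning
    merged : ∀ {x y} → SameClass h x y → SameClass (suc h) x y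
    merged (inj₁ x≡y)        = inj₁ x≡y
    merged (inj₂ (x∉ , y∉)) = inj₁ (one-outside _ _ x∉ y∉)

  stable⇒sameClass-suc : ∀ {h x y} → Stable G S h → SameClass h x y → SameClass (suc h) x y
  stable⇒sameClass-suc {h} {x} {y} stable x~y = isYes-sound (sameClass? (suc h) x y) (begin
    isYes (sameClass? (suc h) x y)   ≡⟨ sameWL-from-ε (suc h) x y ⟨
    sameWL G S (suc h) ε x ε y       ≡⟨ stable ε x ε y ⟩
    sameWL G S h ε x ε y             ≡⟨ sameWL-from-ε h x y ⟩
    isYes (sameClass? h x y)         ≡⟨ isYes-true (sameClass? h x y) x~y ⟩
    true                             ∎)
    where open ≡-Reasoning

  module Generated (generates : Generates G S) where

    reachable : ∀ x → ∃[ m ] Walk G S m ε x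
    reachable x with generates x
    ... | xs , xs⊆S , refl = product-walk xs⊆S
      where
      product-walk : ∀ {xs} → All (_∈ S) xs → ∃[ m ] Walk G S m ε (foldr _∙_ ε xs)
      product-walk []         = 0 , here
      product-walk (s∈ ∷ ss) = let m , p = product-walk ss in m + 1 , walk-++ p (step _ s∈ here)

    distance : ∀ x → ∃[ m ] IsDist G S ε x m
    distance x = let m , p = reachable x in shortest m p

    annulus-nonempty : ∀ {h x} → ¬ Ball h x → ∃[ z ] (¬ Ball h z × Ball (suc h) z)
    annulus-nonempty {h} {x} x∉ with distance x
    ... | m , x-dist with geodesic-prefix (ℕ.≰⇒> λ m≤2^h → x∉ (ball (walk-pad m≤2^h (proj₁ x-dist)))) x-dist
    ... | z , p , far = z , (λ (ball q) → far (2 ^ h) (ℕ.n<1+n (2 ^ h)) q) , ball (walk-pad (1+2^h≤2^[1+h] h) p)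

    stable⇒ball-suc : ∀ {h x} → Stable G S h → ¬ Ball h x → Ball (suc h) x
    stable⇒ball-suc stable x∉ with annulus-nonempty x∉
    ... | z , z∉ , z∈ with stable⇒sameClass-suc stable (inj₂ (z∉ , x∉))
    ... | inj₁ refl      = z∈
    ... | inj₂ (z∉′ , _) = ⊥-elim (z∉′ z∈)

    stable⇒atMostOneOutside : ∀ {h} → Stable G S h → AtMostOneOutside h
    stable⇒atMostOneOutside stable x y x∉ y∉ with stable⇒sameClass-suc stable (inj₂ (x∉ , y∉))
    ... | inj₁ x≡y       = x≡y
    ... | inj₂ (x∉′ , _) = ⊥-elim (x∉′ (stable⇒ball-suc stable x∉))

    isWL : ∀ {h} → AtMostOneOutside h → (∀ k → k < h → ¬ AtMostOneOutside k) → IsWL G S h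
    isWL one-outside below = atMostOneOutside⇒stable one-outside , λ k k<h → below k k<h ∘ stable⇒atMostOneOutside

    module Diameter (D : ℕ) (diameter : IsDiam G S D) where

      within-D : ∀ x → Walk G S D ε x
      within-D x = let m , x-dist = distance x in walk-pad (proj₂ diameter ε x m x-dist) (proj₁ x-dist)

      antipode : Fin n
      antipode = let g , g′ , _ = proj₁ diameter in g′ // g

      antipode-dist : IsDist G S ε antipode D
      antipode-dist = let _ , _ , g-g′-dist = proj₁ diameter in dist-toε g-g′-dist

      D≤2^h⇒atMostOneOutside : ∀ {h} → D ≤ 2 ^ h → AtMostOneOutside h
      D≤2^h⇒atMostOneOutside D≤2^h x _ x∉ _ = ⊥-elim (x∉ (ball (walk-pad D≤2^h (within-D x))))

      atMostOneOutside⇒D≤1+2^h : ∀ {h} → AtMostOneOutside h → D ≤ suc (2 ^ h)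
      atMostOneOutside⇒D≤1+2^h {h} one-outside = ℕ.≮⇒≥ λ 1+2^h<D →
        let z , p , far = geodesic-prefix (ℕ.<⇒≤ 1+2^h<D) antipode-dist
            antipode≡z  = one-outside antipode z
                            (λ (ball q) → proj₂ antipode-dist (2 ^ h) (ℕ.<-trans (ℕ.n<1+n _) 1+2^h<D) q)
                            (λ (ball q) → far (2 ^ h) (ℕ.n<1+n _) q)
        in proj₂ antipode-dist (suc (2 ^ h)) 1+2^h<D (subst (Walk G S _ ε) (sym antipode≡z) p)

      uniqueAntipodes⇒atMostOneOutside : ∀ {h} → D ∸ 1 ≤ 2 ^ h → UniqueAntipodes G S D → AtMostOneOutside h
      uniqueAntipodes⇒atMostOneOutside {h} D∸1≤2^h unique x y x∉ y∉ =
        trans (is-antipode x (antipodal x∉)) (sym (is-antipode y (antipodal y∉)))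
        where
        is-antipode = proj₂ (proj₂ (unique ε))
        antipodal : ∀ {x} → ¬ Ball h x → IsDist G S ε x D
        antipodal {x} x∉ = within-D x , λ k k<D q →
          x∉ (ball (walk-pad (ℕ.≤-trans (ℕ.∸-monoˡ-≤ 1 k<D) D∸1≤2^h) q))

      atMostOneOutside⇒uniqueAntipodes : ∀ {h} → suc (2 ^ h) ≡ D → AtMostOneOutside h → UniqueAntipodes G S D
      atMostOneOutside⇒uniqueAntipodes {h} refl one-outside g = antipode ∙ g , g-dist , only
        where
        g-dist : IsDist G S g (antipode ∙ g) D
        g-dist = dist-fromε (subst (λ z → IsDist G S ε z D) (sym (//-rightDividesʳ g antipode)) antipode-dist)
        outside : ∀ {x} → IsDist G S ε x D → ¬ Ball h x
        outside x-dist (ball q) = proj₂ x-dist (2 ^ h) (ℕ.n<1+n _) q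
        only : ∀ g″ → IsDist G S g g″ D → g″ ≡ antipode ∙ g
        only g″ g″-dist = //-cancelʳ (trans (one-outside _ _ (outside (dist-toε g″-dist)) (outside antipode-dist))
                                            (sym (//-rightDividesʳ g antipode)))

theorem3 : (G : FiniteGroup) (S : Subset (FiniteGroup.n G)) →
    FiniteGroup.ε G ∈ S → InverseClosed G S → Generates G S →
    (D : ℕ) → IsDiam G S D →
    (UniqueAntipodes G S D → IsWL G S ⌈log₂ (D ∸ 1) ⌉)
    × (¬ UniqueAntipodes G S D → IsWL G S ⌈log₂ D ⌉)
theorem3 G S ε∈S _ generates D diameter = unique-case , non-unique-case
  where
  open Cayley G S ε∈S
  open Generated generates
  open Diameter D diameter

  unique-case : UniqueAntipodes G S D → IsWL G S ⌈log₂ (D ∸ 1) ⌉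
  unique-case unique = isWL (uniqueAntipodes⇒atMostOneOutside (n≤2^⌈log₂n⌉ (D ∸ 1)) unique)
    λ k k<h one-outside →
      ℕ.<⇒≱ (k<⌈log₂n⌉⇒2^k<n k<h) (ℕ.∸-monoˡ-≤ 1 (atMostOneOutside⇒D≤1+2^h one-outside))

  non-unique-case : ¬ UniqueAntipodes G S D → IsWL G S ⌈log₂ D ⌉
  non-unique-case non-unique = isWL (D≤2^h⇒atMostOneOutside (n≤2^⌈log₂n⌉ D))
    λ k k<h one-outside → non-unique (atMostOneOutside⇒uniqueAntipodes
      (ℕ.≤-antisym (k<⌈log₂n⌉⇒2^k<n k<h) (atMostOneOutside⇒D≤1+2^h one-outside)) one-outside)
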